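{- Let $n\ge 5$. Among all polyomino chains with $n$ squares, the chains maximizing the augmented Zagreb index $AZI$ are exactly: the chain $AZ^1_{(n-1)/2}$ when $n$ is odd, and the chains of the family $AZ^2_{n/2}$ when $n$ is even. Moreover, the maximum value is $$M(n)=\frac{4456}{125}n-\frac{26763}{2000}-\frac{2312}{3375}\,I_{\{n\text{ even}\}},$$ where $I_{\{n\text{ even}\}}$ equals $1$ if $n$ is even and $0$ otherwise.
   Context: Polyomino chains (restricted model). For $n\ge 2$, a polyomino chain with $n$ squares is a sequence of closed unit squares $S_1,\dots,S_n$ in the plane with $S_1=[0,1]\times[0,1]$, $S_2=[1,2]\times[0,1]$, and for $k\ge 3$, $S_k=S_{k-1}+v_k$, where $v_2=(1,0)$ and each $v_k\in\{(1,0),(0,-1)\}$ satisfies $v_k=v_{k-1}$ if $L_k=1$ and $v_k\neq v_{k-1}$ if $L_k=2$. For $n\ge3$ the chain is determined by its link vector $(L_3,\dots,L_n)\in\{1,2\}^{n-2}$ and denoted $PC(L_3,\dots,L_n)$. Each chain is regarded as the graph whose vertices are the corners of the squares and whose edges are the sides of the squares. The augmented Zagreb index is $AZI(G)=\sum_{uv\in E(G)}\left(\frac{d_ud_v}{d_u+d_v-2}\right)^3$, where $d_u$ is the degree of $u$. Segments: a segment of a chain is a maximal run of consecutive squares $S_a,S_{a+1},\dots,S_b$ ($b>a$) lying in a common row or a common column; consecutive segments share exactly one square (a kink, where the chain changes direction), so a chain with $m$ segments of lengths (numbers of squares) $l_1,\dots,l_m$ satisfies $\sum l_i=n+m-1$.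 A segment is external if it contains $S_1$ or $S_n$, and internal otherwise. $AZ^1_m$ ($m\ge2$) denotes the polyomino chain with $m$ segments all of length 3; $AZ^2_m$ ($m\ge3$) denotes the family of polyomino chains with $m$ segments all of length 3 except exactly one internal segment of length 2. -}

module Defs where

open import Data.Bool using (Bool; true; false; not; if_then_else_)
open import Data.Nat as ℕ using (ℕ; zero; suc; _∸_)
open import Data.Nat.DivMod using (_%_; _/_)
open import Data.Integer as ℤ using (ℤ; +_; -_)
open import Data.Rational as ℚ using (ℚ; 0ℚ)
open import Data.Product using (_×_; _,_; proj₁; proj₂; ∃-syntax)
open import Data.Product.Properties using (≡-dec)
open import Data.Sum using (_⊎_)
open import Data.List as List using (List; []; _∷_; _++_; replicate; length; filter; deduplicate; foldr)
open import Data.Vec using (Vec; toList)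
open import Relation.Nullary.Decidable using (Dec; _⊎-dec_)
open import Relation.Binary.PropositionalEquality using (_≡_)

data Link : Set where
  one two : Link

-- Lattice points and unit edges (u , v) with u the left/bottom endpoint
Point : Set
Point = ℤ × ℤ

Edge : Set
Edge = Point × Point

_≟p_ : (p q : Point) → Dec (p ≡ q)
_≟p_ = ≡-dec ℤ._≟_ ℤ._≟_

_≟e_ : (e f : Edge) → Dec (e ≡ f)
_≟e_ = ≡-dec _≟p_ _≟p_

step : Bool → Point → Point
step true  (x , y) = (x ℤ.+ + 1 , y)
step false (x , y) = (x , y ℤ.- + 1)

-- lower-left corners of S_2, S_3, … given previous direction/position and remaining links
cornersFrom : Bool → Point → List Link → List Point
cornersFrom d p [] = []
cornersFrom d p (one ∷ ls) = let p' = step d p in p' ∷ cornersFrom d p' ls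
cornersFrom d p (two ∷ ls) = let d' = not d ; p' = step d' p in p' ∷ cornersFrom d' p' ls

-- lower-left corners of S_1, …, S_n for PC(L_3,…,L_n)
squares : List Link → List Point
squares ls = (+ 0 , + 0) ∷ (+ 1 , + 0) ∷ cornersFrom true (+ 1 , + 0) ls

sides : Point → List Edge
sides (x , y) =
  ((x , y) , (x ℤ.+ + 1 , y)) ∷ ((x , y ℤ.+ + 1) , (x ℤ.+ + 1 , y ℤ.+ + 1)) ∷
  ((x , y) , (x , y ℤ.+ + 1)) ∷ ((x ℤ.+ + 1 , y) , (x ℤ.+ + 1 , y ℤ.+ + 1)) ∷ []

edges : List Link → List Edge
edges ls = deduplicate _≟e_ (List.concatMap sides (squares ls))

degree : List Link → Point → ℕ
degree ls u = length (filter (λ e → (proj₁ e ≟p u) ⊎-dec (proj₂ e ≟p u)) (edges ls))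

-- (a b / (a + b - 2))^3 ; denominators are never 0 in a chain (all degrees ≥ 2)
azTerm : ℕ → ℕ → ℚ
azTerm a b with (a ℕ.+ b) ∸ 2
... | zero = 0ℚ
... | suc k = let q = (+ (a ℕ.* b)) ℚ./ suc k in q ℚ.* q ℚ.* q

AZI : List Link → ℚ
AZI ls = foldr (λ e acc → azTerm (degree ls (proj₁ e)) (degree ls (proj₂ e)) ℚ.+ acc) 0ℚ (edges ls)

AZIchain : (n : ℕ) → Vec Link (n ∸ 2) → ℚ
AZIchain n L = AZI (toList L)

-- segment lengths (numbers of squares) in order from S_1:
-- a link 2 at position k closes the current segment at kink S_{k-1}
segsFrom : ℕ → List Link → List ℕ
segsFrom c [] = c ∷ []
segsFrom c (one ∷ ls) = segsFrom (suc c) ls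
segsFrom c (two ∷ ls) = c ∷ segsFrom 2 ls

segments : List Link → List ℕ
segments = segsFrom 2

IsAZ1 : (m : ℕ) → List Link → Set
IsAZ1 m ls = segments ls ≡ replicate m 3

IsAZ2 : (m : ℕ) → List Link → Set
IsAZ2 m ls = ∃[ a ] ∃[ b ] (suc a ℕ.+ suc (suc b) ≡ m ×
               segments ls ≡ replicate (suc a) 3 ++ 2 ∷ replicate (suc b) 3)

Extremal : (n : ℕ) → List Link → Set
Extremal n ls = (n % 2 ≡ 1 × IsAZ1 ((n ∸ 1) / 2) ls) ⊎ (n % 2 ≡ 0 × IsAZ2 (n / 2) ls)

evenInd : ℕ → ℕ
evenInd n = 1 ∸ (n % 2)

fromℕ : ℕ → ℚ
fromℕ k = (+ k) ℚ./ 1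

M : ℕ → ℚ
M n = ((+ 4456) ℚ./ 125) ℚ.* fromℕ n ℚ.- ((+ 26763) ℚ./ 2000)
      ℚ.- ((+ 2312) ℚ./ 3375) ℚ.* fromℕ (evenInd n)

IsMaximizer : (n : ℕ) → Vec Link (n ∸ 2) → Set
IsMaximizer n L = (L' : Vec Link (n ∸ 2)) → AZIchain n L' ℚ.≤ AZIchain n L

{-# OPTIONS --safe #-}

-- Each step of a chain, right or down, raises the level x − y of its squares by one, so the
-- degree of a vertex is determined by the squares at nearby levels: 216000 · AZI (216000 = 60³)
-- is a sum of natural-number weights, one per square, each computed from a window of five
-- consecutive squares. A potential on these windows, carrying the parity of the remaining
-- length, bounds every weight by 216000 · 4456/125 up to a telescoping difference, with
-- equality exactly when the chain starts and ends straight, no two straight links are adjacent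
-- and two turns in a row occur only where the parity allows: these are the chains AZ¹ and AZ².
-- All local facts are finite computations, checked by evaluation.

module Submission where

open import Defs

open import Data.Bool using (Bool; true; false; not; T; if_then_else_)
open import Data.Bool.Properties using (not-involutive)
open import Data.Empty using (⊥; ⊥-elim)
open import Data.Integer as ℤ using (ℤ; +_; +≤+; +<+)
import Data.Integer.Properties as ℤP
import Data.Integer.Tactic.RingSolver as ℤ-Solver
open import Data.List as List using (List; []; _∷_; _++_; map; filter; length; concatMap; deduplicate; replicate)
import Data.List.Properties as ListP
open import Data.List.Membership.Propositional using (_∈_)
open import Data.List.Relation.Unary.All as All using (All; []; _∷_)
import Data.List.Relation.Unary.All.Properties as AllP
open import Data.List.Relation.Unary.Any using (here; there)
open import Data.Maybe as Maybe using (Maybe; just; nothing)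
open import Data.Nat as ℕ using (ℕ; zero; suc; z≤n; s≤s; _≤_; _∸_)
open import Data.Nat.DivMod using (_%_; _/_; [m+n]%n≡m%n; [m+kn]%n≡m%n; m*n%n≡0; m*n/n≡m)
import Data.Nat.Properties as ℕP
import Data.Nat.Tactic.RingSolver as ℕ-Solver
open import Data.List.Membership.DecPropositional ℕ._≟_ using (_∈?_)
open import Data.Product using (Σ; _×_; _,_; proj₁; proj₂; ∃-syntax)
open import Data.Rational as ℚ using (ℚ; 0ℚ)
import Data.Rational.Properties as ℚP
open import Data.Rational.Solver renaming (module +-*-Solver to ℚ-Solver)
open import Data.Rational.Unnormalised as ℚᵘ using (ℚᵘ; mkℚᵘ; *≡*; *≤*)
import Data.Rational.Unnormalised.Properties as ℚᵘP
open import Data.Sum using (_⊎_; inj₁; inj₂)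
open import Data.Vec as Vec using (Vec; toList)
import Data.Vec.Properties as VecP
open import Function using (_∘_; id)
open import Function.Bundles using (_⇔_; mk⇔; Equivalence)
open import Function.Construct.Composition using (_⇔-∘_)
open import Function.Construct.Identity using (⇔-id)
open import Function.Definitions using (Injective)
open import Level using (0ℓ)
open import Relation.Binary.Core using (Rel)
open import Relation.Binary.Definitions using (DecidableEquality)
open import Relation.Binary.PropositionalEquality
open import Relation.Binary.Structures using (IsPartialOrder)
open import Relation.Nullary using (Dec; yes; no; does; ¬_; ¬?)
open import Relation.Nullary.Decidable as Dec using (_⊎-dec_; _×-dec_; _→-dec_; from-yes; T?)
open import Relation.Unary using (Pred; Decidable; _≐_)

open import Algebra.Properties.AbelianGroup ℤP.+-0-abelianGroup using (∙-cancelˡ)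
open ≡-Reasoning

infixl 6 _⊕_ _⊕ₑ_

origin : Point
origin = + 0 , + 0

_⊕_ : Point → Point → Point
(x , y) ⊕ (a , b) = x ℤ.+ a , y ℤ.+ b

_⊕ₑ_ : Point → Edge → Edge
p ⊕ₑ (u , v) = p ⊕ u , p ⊕ v

⊖_ : Point → Point
⊖ (x , y) = ℤ.- x , ℤ.- y

level : Point → ℤ
level (x , y) = x ℤ.- y

⊕-cancelˡ : ∀ p {a b} → p ⊕ a ≡ p ⊕ b → a ≡ b
⊕-cancelˡ (x , y) eq = cong₂ _,_ (∙-cancelˡ x _ _ (cong proj₁ eq)) (∙-cancelˡ y _ _ (cong proj₂ eq))

⊕ₑ-cancelˡ : ∀ p {e f} → p ⊕ₑ e ≡ p ⊕ₑ f → e ≡ f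
⊕ₑ-cancelˡ p eq = cong₂ _,_ (⊕-cancelˡ p (cong proj₁ eq)) (⊕-cancelˡ p (cong proj₂ eq))

⊕-identityʳ : ∀ p → p ⊕ origin ≡ p
⊕-identityʳ (x , y) = cong₂ _,_ (ℤP.+-identityʳ x) (ℤP.+-identityʳ y)

⊕-⊖-cancel : ∀ p a b → (p ⊕ a) ⊕ ((⊖ a) ⊕ b) ≡ p ⊕ b
⊕-⊖-cancel (x , y) (a₁ , a₂) (b₁ , b₂) = cong₂ _,_ (lemma x a₁ b₁) (lemma y a₂ b₂)
  where
  lemma : ∀ x a b → (x ℤ.+ a) ℤ.+ (ℤ.- a ℤ.+ b) ≡ x ℤ.+ b
  lemma = ℤ-Solver.solve-∀

step-⊕ : ∀ d p a → step d (p ⊕ a) ≡ p ⊕ step d a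
step-⊕ true  (x , y) (a , b) = cong (_, y ℤ.+ b) (ℤP.+-assoc x a (+ 1))
step-⊕ false (x , y) (a , b) = cong (x ℤ.+ a ,_) (ℤP.+-assoc y b (ℤ.- + 1))

step≡⊕ : ∀ d p → step d p ≡ p ⊕ step d origin
step≡⊕ d p = trans (cong (step d) (sym (⊕-identityʳ p))) (step-⊕ d p origin)

sides-⊕ : ∀ p a → sides (p ⊕ a) ≡ map (p ⊕ₑ_) (sides a)
sides-⊕ (x , y) (a , b) rewrite ℤP.+-assoc x a (+ 1) | ℤP.+-assoc y b (+ 1) = refl

level-⊕ : ∀ p a → level (p ⊕ a) ≡ level p ℤ.+ level a
level-⊕ (x , y) (a , b) = lemma x a y b
  where
  lemma : ∀ x a y b → (x ℤ.+ a) ℤ.- (y ℤ.+ b) ≡ (x ℤ.- y) ℤ.+ (a ℤ.- b)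
  lemma = ℤ-Solver.solve-∀

level-step : ∀ d p → level (step d p) ≡ level p ℤ.+ + 1
level-step true  (x , y) = lemma x y
  where
  lemma : ∀ x y → (x ℤ.+ + 1) ℤ.- y ≡ (x ℤ.- y) ℤ.+ + 1
  lemma = ℤ-Solver.solve-∀
level-step false (x , y) = lemma x y
  where
  lemma : ∀ x y → x ℤ.- (y ℤ.- + 1) ≡ (x ℤ.- y) ℤ.+ + 1
  lemma = ℤ-Solver.solve-∀

level-step-< : ∀ d p → level p ℤ.< level (step d p)
level-step-< d p = ℤP.suc[i]≤j⇒i<j (ℤP.≤-reflexive (trans (ℤP.+-comm (+ 1) (level p)) (sym (level-step d p))))

filter-map : ∀ {A B : Set} {P : Pred B 0ℓ} (P? : Decidable P) (f : A → B) xs →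
             filter P? (map f xs) ≡ map f (filter (P? ∘ f) xs)
filter-map P? f [] = refl
filter-map P? f (x ∷ xs) with does (P? (f x))
... | true  = cong (f x ∷_) (filter-map P? f xs)
... | false = filter-map P? f xs

module _ {A : Set} (_≟_ : DecidableEquality A) where

  deduplicateOnto : List A → List A → List A
  deduplicateOnto []       ys = ys
  deduplicateOnto (x ∷ xs) ys = x ∷ filter (¬? ∘ (x ≟_)) (deduplicateOnto xs ys)

  deduplicate-++ : ∀ xs ys → deduplicate _≟_ (xs ++ ys) ≡ deduplicateOnto xs (deduplicate _≟_ ys)
  deduplicate-++ []       ys = refl
  deduplicate-++ (x ∷ xs) ys = cong (λ zs → x ∷ filter (¬? ∘ (x ≟_)) zs) (deduplicate-++ xs ys)

  deduplicateOnto-++ : ∀ xs ys {zs} → All (λ x → All (λ z → ¬ x ≡ z) zs) xs →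
                       deduplicateOnto xs (ys ++ zs) ≡ deduplicateOnto xs ys ++ zs
  deduplicateOnto-++ []       ys _ = refl
  deduplicateOnto-++ (x ∷ xs) ys {zs} (x∉zs ∷ xs∉zs) = cong (x ∷_) (begin
    filter (¬? ∘ (x ≟_)) (deduplicateOnto xs (ys ++ zs))
      ≡⟨ cong (filter (¬? ∘ (x ≟_))) (deduplicateOnto-++ xs ys xs∉zs) ⟩
    filter (¬? ∘ (x ≟_)) (deduplicateOnto xs ys ++ zs)
      ≡⟨ ListP.filter-++ (¬? ∘ (x ≟_)) (deduplicateOnto xs ys) zs ⟩
    filter (¬? ∘ (x ≟_)) (deduplicateOnto xs ys) ++ filter (¬? ∘ (x ≟_)) zs
      ≡⟨ cong (filter (¬? ∘ (x ≟_)) (deduplicateOnto xs ys) ++_) (ListP.filter-all (¬? ∘ (x ≟_)) x∉zs) ⟩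
    filter (¬? ∘ (x ≟_)) (deduplicateOnto xs ys) ++ zs ∎)

deduplicate-map : ∀ {A B : Set} (_≟A_ : DecidableEquality A) (_≟B_ : DecidableEquality B) {f : A → B} →
                  Injective _≡_ _≡_ f → ∀ xs → deduplicate _≟B_ (map f xs) ≡ map f (deduplicate _≟A_ xs)
deduplicate-map _≟A_ _≟B_ {f} f-inj [] = refl
deduplicate-map _≟A_ _≟B_ {f} f-inj (x ∷ xs) = cong (f x ∷_) (begin
  filter (¬? ∘ (f x ≟B_)) (deduplicate _≟B_ (map f xs))
    ≡⟨ cong (filter (¬? ∘ (f x ≟B_))) (deduplicate-map _≟A_ _≟B_ f-inj xs) ⟩
  filter (¬? ∘ (f x ≟B_)) (map f (deduplicate _≟A_ xs))
    ≡⟨ filter-map (¬? ∘ (f x ≟B_)) f (deduplicate _≟A_ xs) ⟩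
  map f (filter (¬? ∘ (f x ≟B_) ∘ f) (deduplicate _≟A_ xs))
    ≡⟨ cong (map f) (ListP.filter-≐ (¬? ∘ (f x ≟B_) ∘ f) (¬? ∘ (x ≟A_)) same-kept (deduplicate _≟A_ xs)) ⟩
  map f (filter (¬? ∘ (x ≟A_)) (deduplicate _≟A_ xs)) ∎)
  where
  same-kept : (λ y → ¬ f x ≡ f y) ≐ (λ y → ¬ x ≡ y)
  same-kept = (λ fx≢fy x≡y → fx≢fy (cong f x≡y)) , (λ x≢y fx≡fy → x≢y (f-inj fx≡fy))

decide-∀ : ∀ {A : Set} {P : Pred A 0ℓ} {xs : List A} → (∀ x → x ∈ xs) → Decidable P → Dec (∀ x → P x)
decide-∀ {xs = xs} complete P? =
  Dec.map′ (λ all x → All.lookup all (complete x)) (λ all → All.tabulate (λ {x} _ → all x)) (All.all? P? xs)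

bools : List Bool
bools = true ∷ false ∷ []

bools-complete : ∀ b → b ∈ bools
bools-complete true  = here refl
bools-complete false = there (here refl)

incident? : (u : Point) → Decidable (λ (e : Edge) → proj₁ e ≡ u ⊎ proj₂ e ≡ u)
incident? u e = (proj₁ e ≟p u) ⊎-dec (proj₂ e ≟p u)

degreeIn : Point → List Edge → ℕ
degreeIn u E = length (filter (incident? u) E)

degreeIn-++ : ∀ u E F → degreeIn u (E ++ F) ≡ degreeIn u E ℕ.+ degreeIn u F
degreeIn-++ u E F = trans (cong length (ListP.filter-++ (incident? u) E F)) (ListP.length-++ (filter (incident? u) E))

degreeIn-⊕ : ∀ p u E → degreeIn (p ⊕ u) (map (p ⊕ₑ_) E) ≡ degreeIn u E
degreeIn-⊕ p u E = begin
  length (filter (incident? (p ⊕ u)) (map (p ⊕ₑ_) E))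
    ≡⟨ cong length (filter-map (incident? (p ⊕ u)) (p ⊕ₑ_) E) ⟩
  length (map (p ⊕ₑ_) (filter (incident? (p ⊕ u) ∘ (p ⊕ₑ_)) E))
    ≡⟨ ListP.length-map (p ⊕ₑ_) (filter (incident? (p ⊕ u) ∘ (p ⊕ₑ_)) E) ⟩
  length (filter (incident? (p ⊕ u) ∘ (p ⊕ₑ_)) E)
    ≡⟨ cong length (ListP.filter-≐ (incident? (p ⊕ u) ∘ (p ⊕ₑ_)) (incident? u) same-incidence E) ⟩
  length (filter (incident? u) E) ∎
  where
  same-incidence : (λ e → p ⊕ proj₁ e ≡ p ⊕ u ⊎ p ⊕ proj₂ e ≡ p ⊕ u) ≐ (λ e → proj₁ e ≡ u ⊎ proj₂ e ≡ u)
  same-incidence = Data.Sum.map (⊕-cancelˡ p) (⊕-cancelˡ p) , Data.Sum.map (cong (p ⊕_)) (cong (p ⊕_))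

AllLevels : Pred ℤ 0ℓ → List Edge → Set
AllLevels P = All (λ e → P (level (proj₁ e)) × P (level (proj₂ e)))

AllLevels-⊕ : ∀ {P Q : Pred ℤ 0ℓ} p {E} → (∀ {i} → P i → Q (level p ℤ.+ i)) →
              AllLevels P E → AllLevels Q (map (p ⊕ₑ_) E)
AllLevels-⊕ {P} {Q} p P⇒Q lv = AllP.map⁺ (All.map shift lv)
  where
  shift : ∀ {e} → P (level (proj₁ e)) × P (level (proj₂ e)) → Q (level (proj₁ (p ⊕ₑ e))) × Q (level (proj₂ (p ⊕ₑ e)))
  shift {u , v} (Pu , Pv) = subst Q (sym (level-⊕ p u)) (P⇒Q Pu) , subst Q (sym (level-⊕ p v)) (P⇒Q Pv)

degreeIn-≡0 : ∀ {P} {u E} → AllLevels P E → ¬ P (level u) → degreeIn u E ≡ 0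
degreeIn-≡0 {P} {u} lv ¬Pu = cong length (ListP.filter-none (incident? u) (All.map missing lv))
  where
  missing : ∀ {e} → P (level (proj₁ e)) × P (level (proj₂ e)) → ¬ (proj₁ e ≡ u ⊎ proj₂ e ≡ u)
  missing (P₁ , _) (inj₁ refl) = ¬Pu P₁
  missing (_ , P₂) (inj₂ refl) = ¬Pu P₂

AllLevels⇒≢ : ∀ {P} {E} s → ¬ (P (level (proj₁ s)) × P (level (proj₂ s))) → AllLevels P E → All (λ e → ¬ s ≡ e) E
AllLevels⇒≢ s ¬Ps = All.map (λ Pe s≡e → ¬Ps (subst _ (sym s≡e) Pe))

allLevels? : ∀ {P : Pred ℤ 0ℓ} → Decidable P → Decidable (AllLevels P)
allLevels? P? = All.all? (λ e → P? (level (proj₁ e)) ×-dec P? (level (proj₂ e)))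

-- The edge list of a chain

directions : Bool → List Link → List Bool
directions d []         = []
directions d (one ∷ ls) = d ∷ directions d ls
directions d (two ∷ ls) = not d ∷ directions (not d) ls

chainDirections : List Link → List Bool
chainDirections ls = true ∷ directions true ls

path : Point → List Bool → List Point
path p []       = []
path p (d ∷ ds) = step d p ∷ path (step d p) ds

cornersFrom≡path : ∀ d p ls → cornersFrom d p ls ≡ path p (directions d ls)
cornersFrom≡path d p []         = refl
cornersFrom≡path d p (one ∷ ls) = cong (step d p ∷_) (cornersFrom≡path d (step d p) ls)
cornersFrom≡path d p (two ∷ ls) = cong (step (not d) p ∷_) (cornersFrom≡path (not d) (step (not d) p) ls)

path-⊕ : ∀ p a ds → path (p ⊕ a) ds ≡ map (p ⊕_) (path a ds)
path-⊕ p a []       = refl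
path-⊕ p a (d ∷ ds) rewrite step-⊕ d p a = cong (p ⊕ step d a ∷_) (path-⊕ p (step d a) ds)

-- The sides of the square at (x , y) other than the one shared with the square it was
-- entered from: the left side after a step right (d = true), the top side after a step down.
freshSides : Bool → Point → List Edge
freshSides d (x , y) = bottom ∷ (if d then top else left) ∷ right ∷ []
  where
  bottom = (x , y) , (x ℤ.+ + 1 , y)
  top    = (x , y ℤ.+ + 1) , (x ℤ.+ + 1 , y ℤ.+ + 1)
  left   = (x , y) , (x , y ℤ.+ + 1)
  right  = (x ℤ.+ + 1 , y) , (x ℤ.+ + 1 , y ℤ.+ + 1)

freshSides-⊕ : ∀ d p a → freshSides d (p ⊕ a) ≡ map (p ⊕ₑ_) (freshSides d a)
freshSides-⊕ true  (x , y) (a , b) rewrite ℤP.+-assoc x a (+ 1) | ℤP.+-assoc y b (+ 1) = refl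
freshSides-⊕ false (x , y) (a , b) rewrite ℤP.+-assoc x a (+ 1) | ℤP.+-assoc y b (+ 1) = refl

freshSides-at : ∀ d q → freshSides d q ≡ map (q ⊕ₑ_) (freshSides d origin)
freshSides-at d q = trans (cong (freshSides d) (sym (⊕-identityʳ q))) (freshSides-⊕ d q origin)

freshEdges : Point → List Bool → List Edge
freshEdges p []       = []
freshEdges p (d ∷ ds) = freshSides d (step d p) ++ freshEdges (step d p) ds

freshEdges-⊕ : ∀ p a ds → freshEdges (p ⊕ a) ds ≡ map (p ⊕ₑ_) (freshEdges a ds)
freshEdges-⊕ p a []       = refl
freshEdges-⊕ p a (d ∷ ds) = begin
  freshSides d (step d (p ⊕ a)) ++ freshEdges (step d (p ⊕ a)) ds
    ≡⟨ cong (λ q → freshSides d q ++ freshEdges q ds) (step-⊕ d p a) ⟩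
  freshSides d (p ⊕ b) ++ freshEdges (p ⊕ b) ds
    ≡⟨ cong₂ _++_ (freshSides-⊕ d p b) (freshEdges-⊕ p b ds) ⟩
  map (p ⊕ₑ_) (freshSides d b) ++ map (p ⊕ₑ_) (freshEdges b ds)
    ≡⟨ ListP.map-++ (p ⊕ₑ_) (freshSides d b) (freshEdges b ds) ⟨
  map (p ⊕ₑ_) (freshSides d b ++ freshEdges b ds) ∎
  where
  b = step d a

freshEdges-at : ∀ p ds → freshEdges p ds ≡ map (p ⊕ₑ_) (freshEdges origin ds)
freshEdges-at p ds = trans (cong (λ q → freshEdges q ds) (sym (⊕-identityʳ p))) (freshEdges-⊕ p origin ds)

freshSides-levels : ∀ d → AllLevels (ℤ.- + 1 ℤ.≤_) (freshSides d origin)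
freshSides-levels = from-yes (decide-∀ bools-complete λ d → allLevels? (ℤ.- + 1 ℤ.≤?_) (freshSides d origin))

freshEdges-levels : ∀ p ds → AllLevels (level p ℤ.≤_) (freshEdges p ds)
freshEdges-levels p []       = []
freshEdges-levels p (d ∷ ds) =
  AllP.++⁺ (subst (AllLevels (level p ℤ.≤_)) (sym (freshSides-at d q))
                  (AllLevels-⊕ {Q = level p ℤ.≤_} q above (freshSides-levels d)))
           (All.map (Data.Product.map below below) (freshEdges-levels q ds))
  where
  q = step d p
  p≤q : level p ℤ.≤ level q
  p≤q = ℤP.<⇒≤ (level-step-< d p)
  below : ∀ {i} → level q ℤ.≤ i → level p ℤ.≤ i
  below = ℤP.≤-trans p≤q
  above : ∀ {i} → ℤ.- + 1 ℤ.≤ i → level p ℤ.≤ level q ℤ.+ i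
  above {i} -1≤i = subst₂ ℤ._≤_ (sym (lemma (level p))) (cong (ℤ._+ i) (sym (level-step d p)))
                            (ℤP.+-monoʳ-≤ (level p ℤ.+ + 1) -1≤i)
    where
    lemma : ∀ j → j ≡ (j ℤ.+ + 1) ℤ.+ ℤ.- + 1
    lemma = ℤ-Solver.solve-∀

squares≡path : ∀ ls → squares ls ≡ origin ∷ path origin (chainDirections ls)
squares≡path ls = cong (λ ps → origin ∷ step true origin ∷ ps) (cornersFrom≡path true (step true origin) ls)

concatMap-sides-⊕ : ∀ p X → concatMap sides (map (p ⊕_) X) ≡ map (p ⊕ₑ_) (concatMap sides X)
concatMap-sides-⊕ p X = begin
  concatMap sides (map (p ⊕_) X)        ≡⟨ ListP.concatMap-map sides (p ⊕_) X ⟩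
  concatMap (sides ∘ (p ⊕_)) X          ≡⟨ ListP.concatMap-cong (sides-⊕ p) X ⟩
  concatMap (map (p ⊕ₑ_) ∘ sides) X     ≡⟨ ListP.map-concatMap (p ⊕ₑ_) sides X ⟨
  map (p ⊕ₑ_) (concatMap sides X)       ∎

sharedSide : ∀ d → deduplicateOnto _≟e_ (sides origin) (map (step d origin ⊕ₑ_) (sides origin))
                   ≡ sides origin ++ freshSides d (step d origin)
sharedSide true  = refl
sharedSide false = refl

deduplicate-squares : ∀ ds → deduplicate _≟e_ (concatMap sides (origin ∷ path origin ds))
                             ≡ sides origin ++ freshEdges origin ds
deduplicate-squares []       = refl
deduplicate-squares (d ∷ ds) = begin
  deduplicate _≟e_ (sides origin ++ concatMap sides (q ∷ path q ds))
    ≡⟨ cong (λ X → deduplicate _≟e_ (sides origin ++ X)) translated ⟩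
  deduplicate _≟e_ (sides origin ++ map (q ⊕ₑ_) Y)
    ≡⟨ deduplicate-++ _≟e_ (sides origin) (map (q ⊕ₑ_) Y) ⟩
  deduplicateOnto _≟e_ (sides origin) (deduplicate _≟e_ (map (q ⊕ₑ_) Y))
    ≡⟨ cong (deduplicateOnto _≟e_ (sides origin)) (deduplicate-map _≟e_ _≟e_ (⊕ₑ-cancelˡ q) Y) ⟩
  deduplicateOnto _≟e_ (sides origin) (map (q ⊕ₑ_) (deduplicate _≟e_ Y))
    ≡⟨ cong (λ Z → deduplicateOnto _≟e_ (sides origin) (map (q ⊕ₑ_) Z)) (deduplicate-squares ds) ⟩
  deduplicateOnto _≟e_ (sides origin) (map (q ⊕ₑ_) (sides origin ++ freshEdges origin ds))
    ≡⟨ cong (deduplicateOnto _≟e_ (sides origin)) moved ⟩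
  deduplicateOnto _≟e_ (sides origin) (map (q ⊕ₑ_) (sides origin) ++ freshEdges q ds)
    ≡⟨ deduplicateOnto-++ _≟e_ (sides origin) (map (q ⊕ₑ_) (sides origin)) new ⟩
  deduplicateOnto _≟e_ (sides origin) (map (q ⊕ₑ_) (sides origin)) ++ freshEdges q ds
    ≡⟨ cong (_++ freshEdges q ds) (sharedSide d) ⟩
  (sides origin ++ freshSides d q) ++ freshEdges q ds
    ≡⟨ ListP.++-assoc (sides origin) (freshSides d q) (freshEdges q ds) ⟩
  sides origin ++ freshEdges origin (d ∷ ds) ∎
  where
  q = step d origin
  Y = concatMap sides (origin ∷ path origin ds)
  translated : concatMap sides (q ∷ path q ds) ≡ map (q ⊕ₑ_) Y
  translated = trans (cong (λ p → concatMap sides (p ∷ path p ds)) (sym (⊕-identityʳ q)))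
                     (trans (cong (λ ps → concatMap sides (q ⊕ origin ∷ ps)) (path-⊕ q origin ds))
                            (concatMap-sides-⊕ q (origin ∷ path origin ds)))
  moved : map (q ⊕ₑ_) (sides origin ++ freshEdges origin ds) ≡ map (q ⊕ₑ_) (sides origin) ++ freshEdges q ds
  moved = trans (ListP.map-++ (q ⊕ₑ_) (sides origin) (freshEdges origin ds))
                (cong (map (q ⊕ₑ_) (sides origin) ++_) (sym (freshEdges-at q ds)))
  levels : AllLevels (+ 1 ℤ.≤_) (freshEdges q ds)
  levels = subst (λ k → AllLevels (k ℤ.≤_) (freshEdges q ds)) (level-step d origin) (freshEdges-levels q ds)
  new : All (λ s → All (λ e → ¬ s ≡ e) (freshEdges q ds)) (sides origin)
  new = All.map (λ {s} low → AllLevels⇒≢ {P = + 1 ℤ.≤_} s low levels)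
                (from-yes (All.all? (λ s → ¬? ((+ 1 ℤ.≤? level (proj₁ s)) ×-dec (+ 1 ℤ.≤? level (proj₂ s)))) (sides origin)))

edges≡sides++freshEdges : ∀ ls → edges ls ≡ sides origin ++ freshEdges origin (chainDirections ls)
edges≡sides++freshEdges ls = trans (cong (deduplicate _≟e_ ∘ concatMap sides) (squares≡path ls))
                                   (deduplicate-squares (chainDirections ls))

-- 216000 = 60³ clears every denominator (d_u + d_v − 2)³ with 2 ≤ d_u, d_v ≤ 4.
scaled : ℕ → ℚ
scaled k = + k ℚ./ 216000

toℚᵘ-scaled : ∀ k → ℚ.toℚᵘ (scaled k) ℚᵘ.≃ mkℚᵘ (+ k) 215999
toℚᵘ-scaled k = ℚP.toℚᵘ-fromℚᵘ (mkℚᵘ (+ k) 215999)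

scaled-+ : ∀ a b → scaled (a ℕ.+ b) ≡ scaled a ℚ.+ scaled b
scaled-+ a b = ℚP.toℚᵘ-injective (ℚᵘP.≃-trans (toℚᵘ-scaled (a ℕ.+ b)) (ℚᵘP.≃-trans (*≡* (sum (+ a) (+ b) (+ 216000)))
  (ℚᵘP.≃-sym (ℚᵘP.≃-trans (ℚP.toℚᵘ-homo-+ (scaled a) (scaled b)) (ℚᵘP.+-cong (toℚᵘ-scaled a) (toℚᵘ-scaled b))))))
  where
  sum : ∀ x y d → (x ℤ.+ y) ℤ.* (d ℤ.* d) ≡ (x ℤ.* d ℤ.+ y ℤ.* d) ℤ.* d
  sum = ℤ-Solver.solve-∀

scaled-mono-≤ : ∀ {a b} → a ℕ.≤ b → scaled a ℚ.≤ scaled b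
scaled-mono-≤ {a} {b} a≤b = ℚP.toℚᵘ-cancel-≤ (ℚᵘP.≤-respˡ-≃ (ℚᵘP.≃-sym (toℚᵘ-scaled a))
  (ℚᵘP.≤-respʳ-≃ (ℚᵘP.≃-sym (toℚᵘ-scaled b)) (*≤* (ℤP.*-monoʳ-≤-nonNeg (+ 216000) (+≤+ a≤b)))))

scaled-injective : ∀ {a b} → scaled a ≡ scaled b → a ≡ b
scaled-injective {a} {b} eq with ℚᵘP.≃-trans (ℚᵘP.≃-sym (toℚᵘ-scaled a)) (ℚᵘP.≃-trans (ℚP.toℚᵘ-cong eq) (toℚᵘ-scaled b))
... | *≡* e = ℤP.+-injective (ℤP.*-cancelʳ-≡ (+ a) (+ b) (+ 216000) e)

Degree : ℕ → Set
Degree a = a ∈ 2 ∷ 3 ∷ 4 ∷ []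

weight : ℕ → ℕ → ℕ
weight 3 3 = 2460375
weight 3 4 = 2985984
weight 4 3 = 2985984
weight 4 4 = 4096000
weight _ _ = 1728000

azTerm≡scaled-weight : ∀ {a b} → Degree a → Degree b → azTerm a b ≡ scaled (weight a b)
azTerm≡scaled-weight (here refl)                 (here refl)                 = refl
azTerm≡scaled-weight (here refl)                 (there (here refl))         = refl
azTerm≡scaled-weight (here refl)                 (there (there (here refl))) = refl
azTerm≡scaled-weight (there (here refl))         (here refl)                 = refl
azTerm≡scaled-weight (there (here refl))         (there (here refl))         = refl
azTerm≡scaled-weight (there (here refl))         (there (there (here refl))) = refl
azTerm≡scaled-weight (there (there (here refl))) (here refl)                 = refl
azTerm≡scaled-weight (there (there (here refl))) (there (here refl))         = refl
azTerm≡scaled-weight (there (there (here refl))) (there (there (here refl))) = refl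

azSum : List Edge → List Edge → ℚ
azSum E = List.foldr (λ e acc → azTerm (degreeIn (proj₁ e) E) (degreeIn (proj₂ e) E) ℚ.+ acc) 0ℚ

weightSum : List Edge → List Edge → ℕ
weightSum E = List.foldr (λ e acc → weight (degreeIn (proj₁ e) E) (degreeIn (proj₂ e) E) ℕ.+ acc) 0

ValidDegrees : List Edge → List Edge → Set
ValidDegrees E = All (λ e → Degree (degreeIn (proj₁ e) E) × Degree (degreeIn (proj₂ e) E))

validDegrees? : ∀ E → Decidable (ValidDegrees E)
validDegrees? E = All.all? (λ e → (degreeIn (proj₁ e) E ∈? _) ×-dec (degreeIn (proj₂ e) E ∈? _))

azSum≡scaled-weightSum : ∀ E {L} → ValidDegrees E L → azSum E L ≡ scaled (weightSum E L)
azSum≡scaled-weightSum E {[]}    []               = refl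
azSum≡scaled-weightSum E {e ∷ L} ((a , b) ∷ valid) =
  trans (cong₂ ℚ._+_ (azTerm≡scaled-weight a b) (azSum≡scaled-weightSum E valid))
        (sym (scaled-+ (weight (degreeIn (proj₁ e) E) (degreeIn (proj₂ e) E)) (weightSum E L)))

azSum-++ : ∀ E L L′ → azSum E (L ++ L′) ≡ azSum E L ℚ.+ azSum E L′
azSum-++ E []      L′ = sym (ℚP.+-identityˡ (azSum E L′))
azSum-++ E (e ∷ L) L′ = trans (cong (azTerm (degreeIn (proj₁ e) E) (degreeIn (proj₂ e) E) ℚ.+_) (azSum-++ E L L′))
                              (sym (ℚP.+-assoc (azTerm (degreeIn (proj₁ e) E) (degreeIn (proj₂ e) E)) (azSum E L) (azSum E L′)))

SameDegrees : (Edge → Edge) → List Edge → List Edge → List Edge → Set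
SameDegrees f E E′ =
  All (λ e → degreeIn (proj₁ (f e)) E ≡ degreeIn (proj₁ e) E′ × degreeIn (proj₂ (f e)) E ≡ degreeIn (proj₂ e) E′)

azSum-map : ∀ f E E′ {L} → SameDegrees f E E′ L → azSum E (map f L) ≡ azSum E′ L
azSum-map f E E′ []               = refl
azSum-map f E E′ ((d₁ , d₂) ∷ ds) = cong₂ ℚ._+_ (cong₂ azTerm d₁ d₂) (azSum-map f E E′ ds)

-- Degrees are determined by a window of five consecutive squares

-- How the current square was reached: it is the first square, or the second one entered by
-- the step d (atSecond d), or a later one entered by d from a square entered by d′ (atLater d′ d).
data Recent : Set where
  atFirst  : Recent
  atSecond : Bool → Recent
  atLater  : Bool → Bool → Recent

advance : Recent → Bool → Recent
advance atFirst         d = atSecond d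
advance (atSecond d′)   d = atLater d′ d
advance (atLater _ d′)  d = atLater d′ d

-- The edges placed by the current square and by its predecessor, relative to the current square.
lastEdges : Recent → List Edge
lastEdges atFirst        = sides origin
lastEdges (atSecond d)   = freshSides d origin
lastEdges (atLater _ d)  = freshSides d origin

beforeLastEdges : Recent → List Edge
beforeLastEdges atFirst         = []
beforeLastEdges (atSecond d)    = map ((⊖ step d origin) ⊕ₑ_) (sides origin)
beforeLastEdges (atLater d′ d)  = map ((⊖ step d origin) ⊕ₑ_) (freshSides d′ origin)

recentEdges : Recent → List Edge
recentEdges c = lastEdges c ++ beforeLastEdges c

recentEdges-advance : ∀ c d → recentEdges (advance c d) ≡ freshSides d origin ++ map ((⊖ step d origin) ⊕ₑ_) (lastEdges c)
recentEdges-advance atFirst        d = refl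
recentEdges-advance (atSecond _)   d = refl
recentEdges-advance (atLater _ _)  d = refl

windowEdges : Recent → Bool → List Bool → List Edge
windowEdges c d ahead = recentEdges c ++ freshEdges origin (d ∷ ahead)

-- The weights are opaque: type checking unfolds them only in the finite checks that ask for it.
opaque
  stepWeight : Recent → Bool → List Bool → ℕ
  stepWeight c d ahead = weightSum (windowEdges c d ahead) (freshSides d (step d origin))

  stepWeight-unfold : ∀ c d ahead → stepWeight c d ahead ≡ weightSum (windowEdges c d ahead) (freshSides d (step d origin))
  stepWeight-unfold c d ahead = refl

stepsWeight : Recent → List Bool → ℕ
stepsWeight c []       = 0
stepsWeight c (d ∷ ds) = stepWeight c d (List.take 2 ds) ℕ.+ stepsWeight (advance c d) ds

opaque
  firstSquareWeight : List Bool → ℕ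
  firstSquareWeight ahead = weightSum (sides origin ++ freshEdges origin ahead) (sides origin)

  firstSquareWeight-unfold : ∀ ahead → firstSquareWeight ahead ≡ weightSum (sides origin ++ freshEdges origin ahead) (sides origin)
  firstSquareWeight-unfold ahead = refl

chainWeight : List Link → ℕ
chainWeight ls = firstSquareWeight (List.take 2 (chainDirections ls)) ℕ.+ stepsWeight atFirst (chainDirections ls)

recents : List Recent
recents = atFirst ∷ atSecond true ∷ atSecond false ∷
          atLater true true ∷ atLater true false ∷ atLater false true ∷ atLater false false ∷ []

recents-complete : ∀ c → c ∈ recents
recents-complete atFirst             = here refl
recents-complete (atSecond true)     = there (here refl)
recents-complete (atSecond false)    = there (there (here refl))
recents-complete (atLater true true)   = there (there (there (here refl)))
recents-complete (atLater true false)  = there (there (there (there (here refl))))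
recents-complete (atLater false true)  = there (there (there (there (there (here refl)))))
recents-complete (atLater false false) = there (there (there (there (there (there (here refl))))))

shortDirections : List (List Bool)
shortDirections = [] ∷ (true ∷ []) ∷ (false ∷ []) ∷
                  (true ∷ true ∷ []) ∷ (true ∷ false ∷ []) ∷ (false ∷ true ∷ []) ∷ (false ∷ false ∷ []) ∷ []

take2-complete : ∀ ds → List.take 2 ds ∈ shortDirections
take2-complete []                    = here refl
take2-complete (true ∷ [])           = there (here refl)
take2-complete (false ∷ [])          = there (there (here refl))
take2-complete (true ∷ true ∷ _)     = there (there (there (here refl)))
take2-complete (true ∷ false ∷ _)    = there (there (there (there (here refl))))
take2-complete (false ∷ true ∷ _)    = there (there (there (there (there (here refl)))))
take2-complete (false ∷ false ∷ _)   = there (there (there (there (there (there (here refl))))))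

windowDegrees : ∀ c d ds → ValidDegrees (windowEdges c d (List.take 2 ds)) (freshSides d (step d origin))
windowDegrees c d ds = All.lookup (checked c d) (take2-complete ds)
  where
  checked : ∀ c d → All (λ ahead → ValidDegrees (windowEdges c d ahead) (freshSides d (step d origin))) shortDirections
  checked = from-yes (decide-∀ recents-complete λ c → decide-∀ bools-complete λ d →
              All.all? (λ ahead → validDegrees? (windowEdges c d ahead) (freshSides d (step d origin))) shortDirections)

firstSquareDegrees : ∀ ds → ValidDegrees (sides origin ++ freshEdges origin (List.take 2 ds)) (sides origin)
firstSquareDegrees ds = All.lookup checked (take2-complete ds)
  where
  checked : All (λ ahead → ValidDegrees (sides origin ++ freshEdges origin ahead) (sides origin)) shortDirections
  checked = from-yes (All.all? (λ ahead → validDegrees? (sides origin ++ freshEdges origin ahead) (sides origin)) shortDirections)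

degreeIn-freshEdges-take : ∀ k a ds b → level b ℤ.< level a ℤ.+ + k →
                           degreeIn b (freshEdges a ds) ≡ degreeIn b (freshEdges a (List.take k ds))
degreeIn-freshEdges-take zero    a ds       b b<a =
  degreeIn-≡0 {P = level a ℤ.≤_} (freshEdges-levels a ds) (ℤP.<⇒≱ (subst (level b ℤ.<_) (ℤP.+-identityʳ (level a)) b<a))
degreeIn-freshEdges-take (suc k) a []       b b<a = refl
degreeIn-freshEdges-take (suc k) a (d ∷ ds) b b<a = begin
  degreeIn b (freshSides d a′ ++ freshEdges a′ ds)
    ≡⟨ degreeIn-++ b (freshSides d a′) (freshEdges a′ ds) ⟩
  degreeIn b (freshSides d a′) ℕ.+ degreeIn b (freshEdges a′ ds)
    ≡⟨ cong (degreeIn b (freshSides d a′) ℕ.+_) (degreeIn-freshEdges-take k a′ ds b b<a′) ⟩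
  degreeIn b (freshSides d a′) ℕ.+ degreeIn b (freshEdges a′ (List.take k ds))
    ≡⟨ degreeIn-++ b (freshSides d a′) (freshEdges a′ (List.take k ds)) ⟨
  degreeIn b (freshSides d a′ ++ freshEdges a′ (List.take k ds)) ∎
  where
  a′ = step d a
  b<a′ : level b ℤ.< level a′ ℤ.+ + k
  b<a′ = subst (level b ℤ.<_) (sym (trans (cong (ℤ._+ + k) (level-step d a)) (ℤP.+-assoc (level a) (+ 1) (+ k)))) b<a

beforeLastEdges-levels : ∀ c → AllLevels (ℤ._≤ + 0) (beforeLastEdges c)
beforeLastEdges-levels = from-yes (decide-∀ recents-complete λ c → allLevels? (ℤ._≤? + 0) (beforeLastEdges c))

freshSides-step-levels : ∀ d → AllLevels (λ i → + 0 ℤ.≤ i × i ℤ.≤ + 2) (freshSides d (step d origin))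
freshSides-step-levels = from-yes (decide-∀ bools-complete λ d →
  allLevels? (λ i → (+ 0 ℤ.≤? i) ×-dec (i ℤ.≤? + 2)) (freshSides d (step d origin)))

sides-levels : AllLevels (ℤ._≤ + 1) (sides origin)
sides-levels = from-yes (allLevels? (ℤ._≤? + 1) (sides origin))

-- All squares before the last two lie below level p, so at levels ≥ level p the placed edges
-- are the recent ones.
Agrees : List Edge → Point → Recent → Set
Agrees placed p c = ∀ u → level p ℤ.≤ level u → degreeIn u placed ≡ degreeIn u (map (p ⊕ₑ_) (recentEdges c))

Agrees-initial : Agrees (sides origin) origin atFirst
Agrees-initial u _ = refl

map-⊕ₑ-⊖ : ∀ d p X → map (step d p ⊕ₑ_) (map ((⊖ step d origin) ⊕ₑ_) X) ≡ map (p ⊕ₑ_) X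
map-⊕ₑ-⊖ d p X = trans (sym (ListP.map-∘ X)) (ListP.map-cong back X)
  where
  back : ∀ e → step d p ⊕ₑ ((⊖ step d origin) ⊕ₑ e) ≡ p ⊕ₑ e
  back (u , v) rewrite step≡⊕ d p = cong₂ _,_ (⊕-⊖-cancel p (step d origin) u) (⊕-⊖-cancel p (step d origin) v)

degreeIn-map-++ : ∀ u (f : Edge → Edge) A B → degreeIn u (map f (A ++ B)) ≡ degreeIn u (map f A) ℕ.+ degreeIn u (map f B)
degreeIn-map-++ u f A B = trans (cong (degreeIn u) (ListP.map-++ f A B)) (degreeIn-++ u (map f A) (map f B))

Agrees-step : ∀ {placed p c} d → Agrees placed p c → Agrees (placed ++ freshSides d (step d p)) (step d p) (advance c d)
Agrees-step {placed} {p} {c} d agrees u q≤u = begin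
  degreeIn u (placed ++ freshSides d q)
    ≡⟨ degreeIn-++ u placed (freshSides d q) ⟩
  degreeIn u placed ℕ.+ degreeIn u (freshSides d q)
    ≡⟨ cong₂ ℕ._+_ (trans (agrees u (ℤP.≤-trans p≤q q≤u)) (degreeIn-map-++ u (p ⊕ₑ_) (lastEdges c) (beforeLastEdges c)))
                   (cong (degreeIn u) (freshSides-at d q)) ⟩
  (degreeIn u (map (p ⊕ₑ_) (lastEdges c)) ℕ.+ degreeIn u (map (p ⊕ₑ_) (beforeLastEdges c))) ℕ.+ new
    ≡⟨ cong (λ k → (old ℕ.+ k) ℕ.+ new) beforeLast-vanishes ⟩
  (old ℕ.+ 0) ℕ.+ new
    ≡⟨ trans (cong (ℕ._+ new) (ℕP.+-identityʳ old)) (ℕP.+-comm old new) ⟩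
  new ℕ.+ old
    ≡⟨ cong (λ X → new ℕ.+ degreeIn u X) (map-⊕ₑ-⊖ d p (lastEdges c)) ⟨
  new ℕ.+ degreeIn u (map (q ⊕ₑ_) (map ((⊖ step d origin) ⊕ₑ_) (lastEdges c)))
    ≡⟨ degreeIn-map-++ u (q ⊕ₑ_) (freshSides d origin) (map ((⊖ step d origin) ⊕ₑ_) (lastEdges c)) ⟨
  degreeIn u (map (q ⊕ₑ_) (freshSides d origin ++ map ((⊖ step d origin) ⊕ₑ_) (lastEdges c)))
    ≡⟨ cong (degreeIn u ∘ map (q ⊕ₑ_)) (recentEdges-advance c d) ⟨
  degreeIn u (map (q ⊕ₑ_) (recentEdges (advance c d))) ∎
  where
  q = step d p
  new = degreeIn u (map (q ⊕ₑ_) (freshSides d origin))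
  old = degreeIn u (map (p ⊕ₑ_) (lastEdges c))
  p<q : level p ℤ.< level q
  p<q = level-step-< d p
  p≤q : level p ℤ.≤ level q
  p≤q = ℤP.<⇒≤ p<q
  beforeLast-vanishes : degreeIn u (map (p ⊕ₑ_) (beforeLastEdges c)) ≡ 0
  beforeLast-vanishes = degreeIn-≡0 {P = ℤ._≤ level p}
    (AllLevels-⊕ {Q = ℤ._≤ level p} p
                 (λ {i} i≤0 → subst (level p ℤ.+ i ℤ.≤_) (ℤP.+-identityʳ (level p)) (ℤP.+-monoʳ-≤ (level p) i≤0))
                 (beforeLastEdges-levels c))
    (ℤP.<⇒≱ (ℤP.<-≤-trans p<q q≤u))

degreeIn-window : ∀ {placed p c} d ds → Agrees placed p c → ∀ b → + 0 ℤ.≤ level b → level b ℤ.≤ + 2 →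
                  degreeIn (p ⊕ b) (placed ++ freshEdges p (d ∷ ds)) ≡ degreeIn b (windowEdges c d (List.take 2 ds))
degreeIn-window {placed} {p} {c} d ds agrees b 0≤b b≤2 = begin
  degreeIn (p ⊕ b) (placed ++ freshEdges p (d ∷ ds))
    ≡⟨ degreeIn-++ (p ⊕ b) placed (freshEdges p (d ∷ ds)) ⟩
  degreeIn (p ⊕ b) placed ℕ.+ degreeIn (p ⊕ b) (freshEdges p (d ∷ ds))
    ≡⟨ cong₂ ℕ._+_ (trans (agrees (p ⊕ b) p≤p⊕b) (degreeIn-⊕ p b (recentEdges c))) ahead ⟩
  degreeIn b (recentEdges c) ℕ.+ degreeIn b (freshEdges origin (d ∷ List.take 2 ds))
    ≡⟨ degreeIn-++ b (recentEdges c) (freshEdges origin (d ∷ List.take 2 ds)) ⟨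
  degreeIn b (windowEdges c d (List.take 2 ds)) ∎
  where
  p≤p⊕b : level p ℤ.≤ level (p ⊕ b)
  p≤p⊕b = subst₂ ℤ._≤_ (ℤP.+-identityʳ (level p)) (sym (level-⊕ p b)) (ℤP.+-monoʳ-≤ (level p) 0≤b)
  ahead : degreeIn (p ⊕ b) (freshEdges p (d ∷ ds)) ≡ degreeIn b (freshEdges origin (d ∷ List.take 2 ds))
  ahead = begin
    degreeIn (p ⊕ b) (freshEdges p (d ∷ ds))
      ≡⟨ cong (degreeIn (p ⊕ b)) (freshEdges-at p (d ∷ ds)) ⟩
    degreeIn (p ⊕ b) (map (p ⊕ₑ_) (freshEdges origin (d ∷ ds)))
      ≡⟨ degreeIn-⊕ p b (freshEdges origin (d ∷ ds)) ⟩
    degreeIn b (freshEdges origin (d ∷ ds))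
      ≡⟨ degreeIn-freshEdges-take 3 origin (d ∷ ds) b (ℤP.≤-<-trans b≤2 (+<+ (ℕP.n<1+n 2))) ⟩
    degreeIn b (freshEdges origin (d ∷ List.take 2 ds)) ∎

azSum-freshEdges : ∀ {placed p} c ds → Agrees placed p c →
                   azSum (placed ++ freshEdges p ds) (freshEdges p ds) ≡ scaled (stepsWeight c ds)
azSum-freshEdges c []       _      = refl
azSum-freshEdges {placed} {p} c (d ∷ ds) agrees = begin
  azSum E (freshSides d q ++ freshEdges q ds)
    ≡⟨ azSum-++ E (freshSides d q) (freshEdges q ds) ⟩
  azSum E (freshSides d q) ℚ.+ azSum E (freshEdges q ds)
    ≡⟨ cong₂ ℚ._+_ current later ⟩
  scaled (stepWeight c d (List.take 2 ds)) ℚ.+ scaled (stepsWeight (advance c d) ds)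
    ≡⟨ scaled-+ (stepWeight c d (List.take 2 ds)) (stepsWeight (advance c d) ds) ⟨
  scaled (stepsWeight c (d ∷ ds)) ∎
  where
  q = step d p
  E = placed ++ freshEdges p (d ∷ ds)
  window : SameDegrees (p ⊕ₑ_) E (windowEdges c d (List.take 2 ds)) (freshSides d (step d origin))
  window = All.map (λ {e} ((0≤u , u≤2) , (0≤v , v≤2)) →
                      degreeIn-window {placed} {p} {c} d ds agrees (proj₁ e) 0≤u u≤2 ,
                      degreeIn-window {placed} {p} {c} d ds agrees (proj₂ e) 0≤v v≤2)
                   (freshSides-step-levels d)
  current : azSum E (freshSides d q) ≡ scaled (stepWeight c d (List.take 2 ds))
  current = begin
    azSum E (freshSides d q)
      ≡⟨ cong (azSum E) (trans (cong (freshSides d) (step≡⊕ d p)) (freshSides-⊕ d p (step d origin))) ⟩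
    azSum E (map (p ⊕ₑ_) (freshSides d (step d origin)))
      ≡⟨ azSum-map (p ⊕ₑ_) E (windowEdges c d (List.take 2 ds)) window ⟩
    azSum (windowEdges c d (List.take 2 ds)) (freshSides d (step d origin))
      ≡⟨ azSum≡scaled-weightSum (windowEdges c d (List.take 2 ds)) (windowDegrees c d ds) ⟩
    scaled (weightSum (windowEdges c d (List.take 2 ds)) (freshSides d (step d origin)))
      ≡⟨ cong scaled (stepWeight-unfold c d (List.take 2 ds)) ⟨
    scaled (stepWeight c d (List.take 2 ds)) ∎
  later : azSum E (freshEdges q ds) ≡ scaled (stepsWeight (advance c d) ds)
  later = trans (cong (λ E → azSum E (freshEdges q ds)) (sym (ListP.++-assoc placed (freshSides d q) (freshEdges q ds))))
                (azSum-freshEdges {placed ++ freshSides d q} {q} (advance c d) ds (Agrees-step {placed} {p} {c} d agrees))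

azSum-firstSquare : ∀ ds → azSum (sides origin ++ freshEdges origin ds) (sides origin) ≡ scaled (firstSquareWeight (List.take 2 ds))
azSum-firstSquare ds = begin
  azSum E (sides origin)
    ≡⟨ cong (azSum E) (ListP.map-id (sides origin)) ⟨
  azSum E (map id (sides origin))
    ≡⟨ azSum-map id E E′ (All.map (λ {e} (b₁ , b₂) → near {proj₁ e} b₁ , near {proj₂ e} b₂) sides-levels) ⟩
  azSum E′ (sides origin)
    ≡⟨ azSum≡scaled-weightSum E′ (firstSquareDegrees ds) ⟩
  scaled (weightSum E′ (sides origin))
    ≡⟨ cong scaled (firstSquareWeight-unfold (List.take 2 ds)) ⟨
  scaled (firstSquareWeight (List.take 2 ds)) ∎
  where
  E  = sides origin ++ freshEdges origin ds
  E′ = sides origin ++ freshEdges origin (List.take 2 ds)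
  near : ∀ {b} → level b ℤ.≤ + 1 → degreeIn b E ≡ degreeIn b E′
  near {b} b≤1 = begin
    degreeIn b E
      ≡⟨ degreeIn-++ b (sides origin) (freshEdges origin ds) ⟩
    degreeIn b (sides origin) ℕ.+ degreeIn b (freshEdges origin ds)
      ≡⟨ cong (degreeIn b (sides origin) ℕ.+_) (degreeIn-freshEdges-take 2 origin ds b (ℤP.≤-<-trans b≤1 (+<+ (ℕP.n<1+n 1)))) ⟩
    degreeIn b (sides origin) ℕ.+ degreeIn b (freshEdges origin (List.take 2 ds))
      ≡⟨ degreeIn-++ b (sides origin) (freshEdges origin (List.take 2 ds)) ⟨
    degreeIn b E′ ∎

AZI≡scaled-chainWeight : ∀ ls → AZI ls ≡ scaled (chainWeight ls)
AZI≡scaled-chainWeight ls = begin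
  AZI ls
    ≡⟨ cong (λ E → azSum E E) (edges≡sides++freshEdges ls) ⟩
  azSum E E
    ≡⟨ azSum-++ E (sides origin) (freshEdges origin ds) ⟩
  azSum E (sides origin) ℚ.+ azSum E (freshEdges origin ds)
    ≡⟨ cong₂ ℚ._+_ (azSum-firstSquare ds) (azSum-freshEdges {sides origin} {origin} atFirst ds Agrees-initial) ⟩
  scaled (firstSquareWeight (List.take 2 ds)) ℚ.+ scaled (stepsWeight atFirst ds)
    ≡⟨ scaled-+ (firstSquareWeight (List.take 2 ds)) (stepsWeight atFirst ds) ⟨
  scaled (chainWeight ls) ∎
  where
  ds = chainDirections ls
  E  = sides origin ++ freshEdges origin ds

record TightBound (x y : ℕ) (P : Set) : Set where
  field
    bound    : x ℕ.≤ y
    equality : x ≡ y ⇔ P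

tightBound? : ∀ x y {P} → Dec P → Dec (TightBound x y P)
tightBound? x y P? = Dec.map′ (λ (b , t , a) → record { bound = b ; equality = mk⇔ t a })
                              (λ tb → TightBound.bound tb , Equivalence.to (TightBound.equality tb) ,
                                      Equivalence.from (TightBound.equality tb))
                              ((x ℕ.≤? y) ×-dec ((x ℕ.≟ y) →-dec P?) ×-dec (P? →-dec (x ℕ.≟ y)))

TightBound-cong : ∀ {x x′ y y′ P} → x ≡ x′ → y ≡ y′ → TightBound x y P → TightBound x′ y′ P
TightBound-cong refl refl tb = tb

TightBound-map : ∀ {x y P Q} → P ⇔ Q → TightBound x y P → TightBound x y Q
TightBound-map P⇔Q tb = record
  { bound    = TightBound.bound tb
  ; equality = mk⇔ (Equivalence.to P⇔Q ∘ Equivalence.to (TightBound.equality tb))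
                   (Equivalence.from (TightBound.equality tb) ∘ Equivalence.from P⇔Q)
  }

TightBound-+ : ∀ {x x′ y y′ P Q} → TightBound x y P → TightBound x′ y′ Q → TightBound (x ℕ.+ x′) (y ℕ.+ y′) (P × Q)
TightBound-+ {x} {x′} {y} {y′} tb tb′ = record
  { bound    = ℕP.+-mono-≤ x≤y x′≤y′
  ; equality = mk⇔ (λ eq → let (x≡y , x′≡y′) = split eq in to (equality tb) x≡y , to (equality tb′) x′≡y′)
                   (λ (p , q) → cong₂ ℕ._+_ (from (equality tb) p) (from (equality tb′) q))
  }
  where
  open TightBound
  open Equivalence using (to; from)
  x≤y = bound tb
  x′≤y′ = bound tb′
  split : x ℕ.+ x′ ≡ y ℕ.+ y′ → x ≡ y × x′ ≡ y′
  split eq = x≡y , ℕP.+-cancelˡ-≡ x x′ y′ (trans eq (cong (ℕ._+ y′) (sym x≡y)))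
    where
    x≡y = ℕP.≤-antisym x≤y (ℕP.+-cancelʳ-≤ y′ y x (subst (ℕ._≤ x ℕ.+ y′) eq (ℕP.+-monoʳ-≤ x x′≤y′)))

TightBound-cancelʳ : ∀ {x y P} k → TightBound (x ℕ.+ k) (y ℕ.+ k) P → TightBound x y P
TightBound-cancelʳ {x} {y} k tb = record
  { bound    = ℕP.+-cancelʳ-≤ k x y (TightBound.bound tb)
  ; equality = mk⇔ (Equivalence.to (TightBound.equality tb) ∘ cong (ℕ._+ k))
                   (ℕP.+-cancelʳ-≡ k x y ∘ Equivalence.from (TightBound.equality tb))
  }

TightBound-∸ : ∀ {x c y P} → TightBound (x ℕ.+ c) y P → TightBound x (y ℕ.∸ c) P
TightBound-∸ {x} {c} {y} tb = record
  { bound    = ℕP.m+n≤o⇒m≤o∸n x (TightBound.bound tb)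
  ; equality = mk⇔ (λ x≡y∸c → Equivalence.to (TightBound.equality tb) (trans (cong (ℕ._+ c) x≡y∸c) (ℕP.m∸n+n≡m c≤y)))
                   (λ p → trans (sym (ℕP.m+n∸n≡m x c)) (cong (ℕ._∸ c) (Equivalence.from (TightBound.equality tb) p)))
  }
  where
  c≤y = ℕP.m+n≤o⇒n≤o x (TightBound.bound tb)

-- The potential argument

even : ℕ → Bool
even zero    = true
even (suc n) = not (even n)

linkBetween : Bool → Bool → Link
linkBetween true  true  = one
linkBetween false false = one
linkBetween true  false = two
linkBetween false true  = two

links : Bool → List Bool → List Link
links a []       = []
links a (b ∷ ds) = linkBetween a b ∷ links b ds

length-links : ∀ a ds → length (links a ds) ≡ length ds
length-links a []       = refl
length-links a (b ∷ ds) = cong suc (length-links b ds)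

_≟ₗ_ : DecidableEquality Link
one ≟ₗ one = yes refl
two ≟ₗ two = yes refl
one ≟ₗ two = no (λ ())
two ≟ₗ one = no (λ ())

-- allowed ℓ ℓ′ r: the link ℓ may be followed by ℓ′ in an optimal chain in which r tells
-- whether an even number of links, ℓ′ included, follows ℓ.
allowed : Link → Link → Bool → Bool
allowed one one _ = false
allowed one two _ = true
allowed two one _ = true
allowed two two r = r

Tight : Link → List Link → Set
Tight ℓ []        = ℓ ≡ one
Tight ℓ (ℓ′ ∷ ls) = T (allowed ℓ ℓ′ (even (length (ℓ′ ∷ ls)))) × Tight ℓ′ ls

-- 216000 · 4456/125; opaque because ℕ._*_ would unfold a literal left argument one successor
-- at a time.
opaque
  slope : ℕ
  slope = 7699968

terminalPotential : ℕ
terminalPotential = 4000000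

lastStep : Recent → Maybe Bool
lastStep atFirst        = nothing
lastStep (atSecond d)   = just d
lastStep (atLater _ d)  = just d

-- potential c a b r: the state is c before the steps a and b, and r tells whether an even number
-- of steps follows b. The values solve the finite optimisation problem: by stepInequality each
-- step weight is at most slope plus the drop in potential, with equality exactly when allowed.
potential : Recent → Bool → Bool → Bool → ℕ
potential c a b r = table (Maybe.map (λ d → linkBetween d a) (lastStep c)) (linkBetween a b) r
  where
  table : Maybe Link → Link → Bool → ℕ
  table _          two true  = 284846
  table _          two false = 432814
  table (just two) one true  = 1690798
  table (just two) one false = 1542830
  table _          one true  = 1165189
  table _          one false = 1017221

opaque
  unfolding stepWeight slope

  stepInequality : ∀ c a b d r → TightBound (stepWeight c a (b ∷ d ∷ []) ℕ.+ potential (advance c a) b d r)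
                                            (slope ℕ.+ potential c a b (not r))
                                            (T (allowed (linkBetween a b) (linkBetween b d) (not r)))
  stepInequality = from-yes (decide-∀ recents-complete λ c → decide-∀ bools-complete λ a → decide-∀ bools-complete λ b →
    decide-∀ bools-complete λ d → decide-∀ bools-complete λ r →
      tightBound? (stepWeight c a (b ∷ d ∷ []) ℕ.+ potential (advance c a) b d r) (slope ℕ.+ potential c a b (not r))
                  (T? (allowed (linkBetween a b) (linkBetween b d) (not r))))

  finalInequality : ∀ c a b → TightBound (stepsWeight c (a ∷ b ∷ []) ℕ.+ terminalPotential)
                                         (slope ℕ.* 2 ℕ.+ potential c a b true)
                                         (linkBetween a b ≡ one)
  finalInequality = from-yes (decide-∀ recents-complete λ c → decide-∀ bools-complete λ a → decide-∀ bools-complete λ b →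
    tightBound? (stepsWeight c (a ∷ b ∷ []) ℕ.+ terminalPotential) (slope ℕ.* 2 ℕ.+ potential c a b true)
                (linkBetween a b ≟ₗ one))

stepsWeight-bound : ∀ c a b rest →
  TightBound (stepsWeight c (a ∷ b ∷ rest) ℕ.+ terminalPotential)
             (slope ℕ.* length (a ∷ b ∷ rest) ℕ.+ potential c a b (even (length rest)))
             (Tight (linkBetween a b) (links b rest))
stepsWeight-bound c a b []       = finalInequality c a b
stepsWeight-bound c a b (d ∷ rest) = conclusion
  where
  r       = even (length rest)
  ℓ       = linkBetween a b
  ℓ′      = linkBetween b d
  w       = stepWeight c a (b ∷ d ∷ [])
  s       = stepsWeight (advance c a) (b ∷ d ∷ rest)
  next    = potential (advance c a) b d r
  current = potential c a b (not r)
  combined : TightBound ((w ℕ.+ next) ℕ.+ (s ℕ.+ terminalPotential))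
                        ((slope ℕ.+ current) ℕ.+ (slope ℕ.* length (b ∷ d ∷ rest) ℕ.+ next))
                        (T (allowed ℓ ℓ′ (not r)) × Tight ℓ′ (links d rest))
  combined = TightBound-+ (stepInequality c a b d r) (stepsWeight-bound (advance c a) b d rest)
  conclusion : TightBound (stepsWeight c (a ∷ b ∷ d ∷ rest) ℕ.+ terminalPotential)
                          (slope ℕ.* length (a ∷ b ∷ d ∷ rest) ℕ.+ current)
                          (Tight ℓ (links b (d ∷ rest)))
  conclusion = TightBound-map same-condition
    (TightBound-cancelʳ next (TightBound-cong (shuffle w next s terminalPotential) (unroll slope (length rest) current next) combined))
    where
    shuffle : ∀ w p s t → (w ℕ.+ p) ℕ.+ (s ℕ.+ t) ≡ ((w ℕ.+ s) ℕ.+ t) ℕ.+ p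
    shuffle = ℕ-Solver.solve-∀
    unroll : ∀ σ n c p → (σ ℕ.+ c) ℕ.+ (σ ℕ.* (2 ℕ.+ n) ℕ.+ p) ≡ (σ ℕ.* (3 ℕ.+ n) ℕ.+ c) ℕ.+ p
    unroll = ℕ-Solver.solve-∀
    same-condition : (T (allowed ℓ ℓ′ (not r)) × Tight ℓ′ (links d rest)) ⇔ Tight ℓ (links b (d ∷ rest))
    same-condition = subst (λ n → (T (allowed ℓ ℓ′ (not r)) × Tight ℓ′ (links d rest)) ⇔
                                  (T (allowed ℓ ℓ′ (not (even n))) × Tight ℓ′ (links d rest)))
                           (sym (length-links d rest)) (⇔-id _)

-- 216000 · (26763/2000 + 2312/3375 · [n even])
offset : ℕ → ℕ
offset n = evenInd n ℕ.* 147968 ℕ.+ 2890404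

evenInd≡ : ∀ n → evenInd n ≡ (if even n then 1 else 0)
evenInd≡ zero          = refl
evenInd≡ (suc zero)    = refl
evenInd≡ (suc (suc n)) = begin
  1 ℕ.∸ suc (suc n) % 2       ≡⟨ cong (λ m → 1 ℕ.∸ m % 2) (ℕP.+-comm 2 n) ⟩
  1 ℕ.∸ (n ℕ.+ 2) % 2         ≡⟨ cong (1 ℕ.∸_) ([m+n]%n≡m%n n 2) ⟩
  evenInd n                   ≡⟨ evenInd≡ n ⟩
  (if even n then 1 else 0)   ≡⟨ cong (λ b → if b then 1 else 0) (not-involutive (even n)) ⟨
  (if even (suc (suc n)) then 1 else 0) ∎

offset-+3 : ∀ k → offset (k ℕ.+ 3) ≡ offset (if even k then 3 else 4)
offset-+3 k = cong (λ i → i ℕ.* 147968 ℕ.+ 2890404)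
                   (trans (cong evenInd (ℕP.+-comm k 3)) (trans (evenInd≡ (3 ℕ.+ k)) (by-parity (even k))))
  where
  by-parity : ∀ b → (if not (not (not b)) then 1 else 0) ≡ evenInd (if b then 3 else 4)
  by-parity true  = refl
  by-parity false = refl

opaque
  unfolding firstSquareWeight slope

  startInequality : ∀ b r → TightBound (offset (if r then 3 else 4) ℕ.+
                                         (firstSquareWeight (true ∷ b ∷ []) ℕ.+ potential atFirst true b r))
                                       (slope ℕ.+ terminalPotential)
                                       (linkBetween true b ≡ one)
  startInequality = from-yes (decide-∀ bools-complete λ b → decide-∀ bools-complete λ r →
    tightBound? (offset (if r then 3 else 4) ℕ.+ (firstSquareWeight (true ∷ b ∷ []) ℕ.+ potential atFirst true b r))
                (slope ℕ.+ terminalPotential) (linkBetween true b ≟ₗ one))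

directionsWeight-bound : ∀ b rest →
  TightBound (firstSquareWeight (true ∷ b ∷ []) ℕ.+ stepsWeight atFirst (true ∷ b ∷ rest) ℕ.+ offset (length rest ℕ.+ 3))
             (slope ℕ.* (length rest ℕ.+ 3))
             (linkBetween true b ≡ one × Tight (linkBetween true b) (links b rest))
directionsWeight-bound b rest =
  TightBound-cong (cong (f ℕ.+ s ℕ.+_) (sym (offset-+3 (length rest)))) refl
    (TightBound-cancelʳ (p ℕ.+ terminalPotential)
      (TightBound-cong (shuffle (offset (if r then 3 else 4)) f p s terminalPotential) (unroll slope terminalPotential (length rest) p)
        (TightBound-+ (startInequality b r) (stepsWeight-bound atFirst true b rest))))
  where
  r = even (length rest)
  f = firstSquareWeight (true ∷ b ∷ [])
  s = stepsWeight atFirst (true ∷ b ∷ rest)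
  p = potential atFirst true b r
  shuffle : ∀ o f p s t → (o ℕ.+ (f ℕ.+ p)) ℕ.+ (s ℕ.+ t) ≡ (f ℕ.+ s ℕ.+ o) ℕ.+ (p ℕ.+ t)
  shuffle = ℕ-Solver.solve-∀
  unroll : ∀ σ t n p → (σ ℕ.+ t) ℕ.+ (σ ℕ.* (2 ℕ.+ n) ℕ.+ p) ≡ σ ℕ.* (n ℕ.+ 3) ℕ.+ (p ℕ.+ t)
  unroll = ℕ-Solver.solve-∀

startDirection : Link → Bool
startDirection one = true
startDirection two = false

length-directions : ∀ d ls → length (directions d ls) ≡ length ls
length-directions d []         = refl
length-directions d (one ∷ ls) = cong suc (length-directions d ls)
length-directions d (two ∷ ls) = cong suc (length-directions (not d) ls)

links-directions : ∀ d ls → links d (directions d ls) ≡ ls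
links-directions true  []         = refl
links-directions false []         = refl
links-directions true  (one ∷ ls) = cong (one ∷_) (links-directions true ls)
links-directions false (one ∷ ls) = cong (one ∷_) (links-directions false ls)
links-directions true  (two ∷ ls) = cong (two ∷_) (links-directions false ls)
links-directions false (two ∷ ls) = cong (two ∷_) (links-directions true ls)

chainWeight-bound : ∀ ℓ ls → TightBound (chainWeight (ℓ ∷ ls) ℕ.+ offset (length ls ℕ.+ 3))
                                        (slope ℕ.* (length ls ℕ.+ 3))
                                        (ℓ ≡ one × Tight ℓ ls)
chainWeight-bound ℓ ls =
  subst₂ (λ n L → TightBound (chainWeight (ℓ ∷ ls) ℕ.+ offset (n ℕ.+ 3)) (slope ℕ.* (n ℕ.+ 3)) (ℓ ≡ one × Tight ℓ L))
         (length-directions (startDirection ℓ) ls) (links-directions (startDirection ℓ) ls) (bound ℓ)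
  where
  bound : ∀ ℓ → TightBound (chainWeight (ℓ ∷ ls) ℕ.+ offset (length (directions (startDirection ℓ) ls) ℕ.+ 3))
                           (slope ℕ.* (length (directions (startDirection ℓ) ls) ℕ.+ 3))
                           (ℓ ≡ one × Tight ℓ (links (startDirection ℓ) (directions (startDirection ℓ) ls)))
  bound one = directionsWeight-bound true (directions true ls)
  bound two = directionsWeight-bound false (directions false ls)

-- The optimal link sequences

alternating : ℕ → List Link
alternating zero    = []
alternating (suc k) = two ∷ one ∷ alternating k

data ExtremalLinks : List Link → Set where
  uniform : ∀ k → ExtremalLinks (one ∷ alternating k)
  defect  : ∀ a b → ExtremalLinks (one ∷ alternating a ++ two ∷ two ∷ one ∷ alternating b)

ExtremalLinks-grow : ∀ {ls} → ExtremalLinks (one ∷ ls) → ExtremalLinks (one ∷ two ∷ one ∷ ls)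
ExtremalLinks-grow (uniform k)  = uniform (suc k)
ExtremalLinks-grow (defect a b) = defect (suc a) b

even-alternating : ∀ k → even (length (alternating k)) ≡ true
even-alternating zero    = refl
even-alternating (suc k) = trans (not-involutive _) (even-alternating k)

even-defect : ∀ a b → even (length (alternating a ++ two ∷ two ∷ one ∷ alternating b)) ≡ false
even-defect zero    b = cong not (trans (not-involutive _) (even-alternating b))
even-defect (suc a) b = trans (not-involutive _) (even-defect a b)

Tight-alternating : ∀ k → Tight one (alternating k)
Tight-alternating zero    = refl
Tight-alternating (suc k) = _ , _ , Tight-alternating k

Tight-alternating-++ : ∀ a {ls} → Tight one ls → Tight one (alternating a ++ ls)
Tight-alternating-++ zero    t = t
Tight-alternating-++ (suc a) t = _ , _ , Tight-alternating-++ a t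

Tight⇒ExtremalLinks : ∀ ls → Tight one ls → ExtremalLinks (one ∷ ls)
Tight⇒ExtremalLinks []                      _              = uniform 0
Tight⇒ExtremalLinks (one ∷ _)               (() , _)
Tight⇒ExtremalLinks (two ∷ [])              (_ , ())
Tight⇒ExtremalLinks (two ∷ one ∷ ls)        (_ , _ , t)    = ExtremalLinks-grow (Tight⇒ExtremalLinks ls t)
Tight⇒ExtremalLinks (two ∷ two ∷ [])        (_ , _ , ())
Tight⇒ExtremalLinks (two ∷ two ∷ two ∷ ls)  (_ , e , e′ , _) = ⊥-elim (parity-clash (even (length ls)) e e′)
  where
  parity-clash : ∀ b → T (not (not b)) → T (not b) → ⊥
  parity-clash true  _ ()
  parity-clash false ()
Tight⇒ExtremalLinks (two ∷ two ∷ one ∷ ls)  (_ , e , _ , t) with Tight⇒ExtremalLinks ls t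
... | uniform k  = defect 0 k
... | defect a b = ⊥-elim (subst (λ x → T (not (not x))) (even-defect a b) e)

ExtremalLinks⇒Tight : ∀ {ls} → ExtremalLinks (one ∷ ls) → Tight one ls
ExtremalLinks⇒Tight (uniform k)  = Tight-alternating k
ExtremalLinks⇒Tight (defect a b) =
  Tight-alternating-++ a (_ , subst (λ x → T (not (not x))) (sym (even-alternating b)) _ , _ , Tight-alternating b)

Tight⇔ExtremalLinks : ∀ ℓ ls → (ℓ ≡ one × Tight ℓ ls) ⇔ ExtremalLinks (ℓ ∷ ls)
Tight⇔ExtremalLinks ℓ ls = mk⇔ (λ { (refl , t) → Tight⇒ExtremalLinks ls t }) from
  where
  from : ∀ {ℓ ls} → ExtremalLinks (ℓ ∷ ls) → ℓ ≡ one × Tight ℓ ls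
  from (uniform k)  = refl , ExtremalLinks⇒Tight (uniform k)
  from (defect a b) = refl , ExtremalLinks⇒Tight (defect a b)

segsFrom3-alternating : ∀ k → segsFrom 3 (alternating k) ≡ replicate (suc k) 3
segsFrom3-alternating zero    = refl
segsFrom3-alternating (suc k) = cong (3 ∷_) (segsFrom3-alternating k)

segsFrom3-defect : ∀ a b → segsFrom 3 (alternating a ++ two ∷ two ∷ one ∷ alternating b) ≡ replicate (suc a) 3 ++ 2 ∷ replicate (suc b) 3
segsFrom3-defect zero    b = cong (λ ss → 3 ∷ 2 ∷ ss) (segsFrom3-alternating b)
segsFrom3-defect (suc a) b = cong (3 ∷_) (segsFrom3-defect a b)

segsFrom-head : ∀ c ls → ∃[ h ] ∃[ hs ] segsFrom c ls ≡ h ∷ hs × c ℕ.≤ h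
segsFrom-head c []         = c , [] , refl , ℕP.≤-refl
segsFrom-head c (one ∷ ls) = let (h , hs , eq , c<h) = segsFrom-head (suc c) ls in h , hs , eq , ℕP.<⇒≤ c<h
segsFrom-head c (two ∷ ls) = c , segsFrom 2 ls , refl , ℕP.≤-refl

segsFrom≢[] : ∀ c ls → ¬ segsFrom c ls ≡ []
segsFrom≢[] c ls eq with segsFrom-head c ls
... | _ , _ , eq′ , _ with trans (sym eq) eq′
... | ()

segsFrom-suc≢ : ∀ c ls hs → ¬ segsFrom (suc c) ls ≡ c ∷ hs
segsFrom-suc≢ c ls hs eq with segsFrom-head (suc c) ls
... | _ , _ , eq′ , c<h with trans (sym eq′) eq
... | refl = ℕP.<-irrefl refl c<h

segsFrom-injective : ∀ c {ls ls′} → segsFrom c ls ≡ segsFrom c ls′ → ls ≡ ls′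
segsFrom-injective c {[]}       {[]}        _  = refl
segsFrom-injective c {[]}       {one ∷ ls′} eq = ⊥-elim (segsFrom-suc≢ c ls′ [] (sym eq))
segsFrom-injective c {[]}       {two ∷ ls′} eq = ⊥-elim (segsFrom≢[] 2 ls′ (sym (ListP.∷-injectiveʳ eq)))
segsFrom-injective c {one ∷ ls} {[]}        eq = ⊥-elim (segsFrom-suc≢ c ls [] eq)
segsFrom-injective c {two ∷ ls} {[]}        eq = ⊥-elim (segsFrom≢[] 2 ls (ListP.∷-injectiveʳ eq))
segsFrom-injective c {one ∷ ls} {one ∷ ls′} eq = cong (one ∷_) (segsFrom-injective (suc c) eq)
segsFrom-injective c {one ∷ ls} {two ∷ ls′} eq = ⊥-elim (segsFrom-suc≢ c ls _ eq)
segsFrom-injective c {two ∷ ls} {one ∷ ls′} eq = ⊥-elim (segsFrom-suc≢ c ls′ _ (sym eq))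
segsFrom-injective c {two ∷ ls} {two ∷ ls′} eq = cong (two ∷_) (segsFrom-injective 2 (ListP.∷-injectiveʳ eq))

Extremal⇒ExtremalLinks : ∀ n ls → Extremal n ls → ExtremalLinks ls
Extremal⇒ExtremalLinks n ls (inj₁ (_ , segs)) with (n ℕ.∸ 1) / 2
... | zero  = ⊥-elim (segsFrom≢[] 2 ls segs)
... | suc k = subst ExtremalLinks (sym (segsFrom-injective 2 (trans segs (sym (segsFrom3-alternating k))))) (uniform k)
Extremal⇒ExtremalLinks n ls (inj₂ (_ , a , b , _ , segs)) =
  subst ExtremalLinks (sym (segsFrom-injective 2 (trans segs (sym (segsFrom3-defect a b))))) (defect a b)

length-alternating : ∀ k → length (alternating k) ≡ k ℕ.* 2
length-alternating zero    = refl
length-alternating (suc k) = cong (suc ∘ suc) (length-alternating k)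

ExtremalLinks⇒Extremal : ∀ {ls} → ExtremalLinks ls → Extremal (length ls ℕ.+ 2) ls
ExtremalLinks⇒Extremal (uniform k) =
  subst (λ n → Extremal n (one ∷ alternating k)) (sym n≡)
    (inj₁ ([m+kn]%n≡m%n 1 (suc k) 2 , trans (segsFrom3-alternating k) (cong (λ m → replicate m 3) (sym (m*n/n≡m (suc k) 2)))))
  where
  n≡ : length (one ∷ alternating k) ℕ.+ 2 ≡ 1 ℕ.+ suc k ℕ.* 2
  n≡ = trans (cong (λ l → suc l ℕ.+ 2) (length-alternating k)) (arithmetic k)
    where
    arithmetic : ∀ k → suc (k ℕ.* 2) ℕ.+ 2 ≡ 1 ℕ.+ suc k ℕ.* 2
    arithmetic = ℕ-Solver.solve-∀
ExtremalLinks⇒Extremal (defect a b) =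
  subst (λ n → Extremal n (one ∷ alternating a ++ two ∷ two ∷ one ∷ alternating b)) (sym n≡)
    (inj₂ (m*n%n≡0 (a ℕ.+ b ℕ.+ 3) 2 , a , b , trans (sizes a b) (sym (m*n/n≡m (a ℕ.+ b ℕ.+ 3) 2)) , segsFrom3-defect a b))
  where
  sizes : ∀ a b → suc a ℕ.+ suc (suc b) ≡ a ℕ.+ b ℕ.+ 3
  sizes = ℕ-Solver.solve-∀
  arithmetic : ∀ a b → suc (a ℕ.* 2 ℕ.+ suc (suc (suc (b ℕ.* 2)))) ℕ.+ 2 ≡ (a ℕ.+ b ℕ.+ 3) ℕ.* 2
  arithmetic = ℕ-Solver.solve-∀
  n≡ : length (one ∷ alternating a ++ two ∷ two ∷ one ∷ alternating b) ℕ.+ 2 ≡ (a ℕ.+ b ℕ.+ 3) ℕ.* 2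
  n≡ = trans (cong (λ l → suc l ℕ.+ 2) (trans (ListP.length-++ (alternating a))
                                              (cong₂ (λ x y → x ℕ.+ suc (suc (suc y))) (length-alternating a) (length-alternating b))))
             (arithmetic a b)

ExtremalLinks⇔Extremal : ∀ ls → ExtremalLinks ls ⇔ Extremal (length ls ℕ.+ 2) ls
ExtremalLinks⇔Extremal ls = mk⇔ ExtremalLinks⇒Extremal (Extremal⇒ExtremalLinks (length ls ℕ.+ 2) ls)

ExtremalLinks-of-length : ∀ m → 3 ℕ.≤ m → ∃[ ls ] length ls ≡ m × ExtremalLinks ls
ExtremalLinks-of-length 1 (s≤s ())
ExtremalLinks-of-length 2 (s≤s (s≤s ()))
ExtremalLinks-of-length 3 _ = _ , refl , uniform 1
ExtremalLinks-of-length 4 _ = _ , refl , defect 0 0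
ExtremalLinks-of-length (suc (suc (suc (suc (suc m))))) _ with ExtremalLinks-of-length (suc (suc (suc m))) (s≤s (s≤s (s≤s z≤n)))
... | one ∷ ls , len , ext = one ∷ two ∷ one ∷ ls , cong (suc ∘ suc) len , ExtremalLinks-grow ext

-- The value of the maximum

unit : ℚ
unit = + 1 ℚ./ 216000

toℚᵘ-fromℕ : ∀ k → ℚ.toℚᵘ (fromℕ k) ℚᵘ.≃ mkℚᵘ (+ k) 0
toℚᵘ-fromℕ k = ℚP.toℚᵘ-fromℚᵘ (mkℚᵘ (+ k) 0)

fromℕ-+ : ∀ a b → fromℕ (a ℕ.+ b) ≡ fromℕ a ℚ.+ fromℕ b
fromℕ-+ a b = ℚP.toℚᵘ-injective (ℚᵘP.≃-trans (toℚᵘ-fromℕ (a ℕ.+ b)) (ℚᵘP.≃-trans (*≡* (sum (+ a) (+ b)))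
  (ℚᵘP.≃-sym (ℚᵘP.≃-trans (ℚP.toℚᵘ-homo-+ (fromℕ a) (fromℕ b)) (ℚᵘP.+-cong (toℚᵘ-fromℕ a) (toℚᵘ-fromℕ b))))))
  where
  sum : ∀ x y → (x ℤ.+ y) ℤ.* (+ 1 ℤ.* + 1) ≡ (x ℤ.* + 1 ℤ.+ y ℤ.* + 1) ℤ.* + 1
  sum = ℤ-Solver.solve-∀

fromℕ-* : ∀ a b → fromℕ (a ℕ.* b) ≡ fromℕ a ℚ.* fromℕ b
fromℕ-* a b = ℚP.toℚᵘ-injective (ℚᵘP.≃-trans (toℚᵘ-fromℕ (a ℕ.* b))
  (ℚᵘP.≃-trans (*≡* (trans (cong (ℤ._* (+ 1 ℤ.* + 1)) (ℤP.pos-* a b)) (product (+ a) (+ b))))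
  (ℚᵘP.≃-sym (ℚᵘP.≃-trans (ℚP.toℚᵘ-homo-* (fromℕ a) (fromℕ b)) (ℚᵘP.*-cong (toℚᵘ-fromℕ a) (toℚᵘ-fromℕ b))))))
  where
  product : ∀ x y → (x ℤ.* y) ℤ.* (+ 1 ℤ.* + 1) ≡ (x ℤ.* y) ℤ.* + 1
  product = ℤ-Solver.solve-∀

scaled≡fromℕ*unit : ∀ k → scaled k ≡ fromℕ k ℚ.* unit
scaled≡fromℕ*unit k = ℚP.toℚᵘ-injective (ℚᵘP.≃-trans (toℚᵘ-scaled k) (ℚᵘP.≃-trans (*≡* (product (+ k)))
  (ℚᵘP.≃-sym (ℚᵘP.≃-trans (ℚP.toℚᵘ-homo-* (fromℕ k) unit) (ℚᵘP.*-cong (toℚᵘ-fromℕ k) ℚᵘP.≃-refl)))))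
  where
  product : ∀ x → x ℤ.* (+ 1 ℤ.* + 216000) ≡ (x ℤ.* + 1) ℤ.* + 216000
  product = ℤ-Solver.solve-∀

opaque
  unfolding slope

  slope-scaled : (+ 4456) ℚ./ 125 ≡ fromℕ slope ℚ.* unit
  slope-scaled = refl

M+offset≡scaled : ∀ n → M n ℚ.+ scaled (offset n) ≡ scaled (slope ℕ.* n)
M+offset≡scaled n = begin
  M n ℚ.+ scaled (offset n)                              ≡⟨ cong₂ ℚ._+_ constants (scaled≡fromℕ*unit (offset n)) ⟩
  M′ ℚ.+ fromℕ (offset n) ℚ.* unit                       ≡⟨ cong (λ x → M′ ℚ.+ x ℚ.* unit) offset≡ ⟩
  M′ ℚ.+ (I ℚ.* fromℕ 147968 ℚ.+ fromℕ 2890404) ℚ.* unit ≡⟨ identity S unit N (fromℕ 2890404) (fromℕ 147968) I ⟩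
  (S ℚ.* N) ℚ.* unit                                     ≡⟨ trans (scaled≡fromℕ*unit (slope ℕ.* n)) (cong (ℚ._* unit) (fromℕ-* slope n)) ⟨
  scaled (slope ℕ.* n)                                   ∎
  where
  open ℚ-Solver
  S = fromℕ slope
  N = fromℕ n
  I = fromℕ (evenInd n)
  M′ = ((S ℚ.* unit) ℚ.* N ℚ.- fromℕ 2890404 ℚ.* unit) ℚ.- (fromℕ 147968 ℚ.* unit) ℚ.* I
  constants : M n ≡ M′
  constants = cong (λ σ → (σ ℚ.* N ℚ.- fromℕ 2890404 ℚ.* unit) ℚ.- (fromℕ 147968 ℚ.* unit) ℚ.* I) slope-scaled
  offset≡ : fromℕ (offset n) ≡ I ℚ.* fromℕ 147968 ℚ.+ fromℕ 2890404
  offset≡ = trans (fromℕ-+ (evenInd n ℕ.* 147968) 2890404) (cong (ℚ._+ fromℕ 2890404) (fromℕ-* (evenInd n) 147968))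
  identity : ∀ s u n b c i →
             (((s ℚ.* u) ℚ.* n ℚ.- b ℚ.* u) ℚ.- (c ℚ.* u) ℚ.* i) ℚ.+ (i ℚ.* c ℚ.+ b) ℚ.* u ≡ (s ℚ.* n) ℚ.* u
  identity = solve 6 (λ s u n b c i → (((s :* u) :* n :- b :* u) :- (c :* u) :* i) :+ (i :* c :+ b) :* u := (s :* n) :* u) refl

scaled-TightBound : ∀ {x y P} → TightBound x y P → scaled x ℚ.≤ scaled y × (scaled x ≡ scaled y ⇔ P)
scaled-TightBound tb = scaled-mono-≤ (TightBound.bound tb) ,
  mk⇔ (Equivalence.to (TightBound.equality tb) ∘ scaled-injective) (cong scaled ∘ Equivalence.from (TightBound.equality tb))

M≡scaled : ∀ n → offset n ℕ.≤ slope ℕ.* n → M n ≡ scaled (slope ℕ.* n ℕ.∸ offset n)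
M≡scaled n o≤s = ∙-cancelʳ (scaled (offset n)) (M n) (scaled (slope ℕ.* n ℕ.∸ offset n)) (begin
  M n ℚ.+ scaled (offset n)                          ≡⟨ M+offset≡scaled n ⟩
  scaled (slope ℕ.* n)                               ≡⟨ cong scaled (ℕP.m∸n+n≡m o≤s) ⟨
  scaled (slope ℕ.* n ℕ.∸ offset n ℕ.+ offset n)     ≡⟨ scaled-+ (slope ℕ.* n ℕ.∸ offset n) (offset n) ⟩
  scaled (slope ℕ.* n ℕ.∸ offset n) ℚ.+ scaled (offset n) ∎)
  where
  open import Algebra.Properties.AbelianGroup ℚP.+-0-abelianGroup using (∙-cancelʳ)

AZI-maximum : ∀ ℓ ls → AZI (ℓ ∷ ls) ℚ.≤ M (length ls ℕ.+ 3) × (AZI (ℓ ∷ ls) ≡ M (length ls ℕ.+ 3) ⇔ ExtremalLinks (ℓ ∷ ls))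
AZI-maximum ℓ ls =
  subst₂ (λ a m → a ℚ.≤ m × (a ≡ m ⇔ ExtremalLinks (ℓ ∷ ls)))
         (sym (AZI≡scaled-chainWeight (ℓ ∷ ls))) (sym (M≡scaled n (ℕP.m+n≤o⇒n≤o (chainWeight (ℓ ∷ ls)) (TightBound.bound tb))))
         (scaled-TightBound (TightBound-map (Tight⇔ExtremalLinks ℓ ls) (TightBound-∸ {chainWeight (ℓ ∷ ls)} {offset n} tb)))
  where
  n  = length ls ℕ.+ 3
  tb = chainWeight-bound ℓ ls

AZI-bounds : ∀ n ls → 3 ℕ.≤ n → length ls ℕ.+ 2 ≡ n → AZI ls ℚ.≤ M n × (AZI ls ≡ M n ⇔ Extremal n ls)
AZI-bounds _ []       (s≤s (s≤s ())) refl
AZI-bounds _ (ℓ ∷ ls) _              refl =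
  subst (λ m → AZI (ℓ ∷ ls) ℚ.≤ M m × (AZI (ℓ ∷ ls) ≡ M m ⇔ Extremal (length (ℓ ∷ ls) ℕ.+ 2) (ℓ ∷ ls)))
        (ℕP.+-suc (length ls) 2)
        (Data.Product.map₂ (ExtremalLinks⇔Extremal (ℓ ∷ ls) ⇔-∘_) (AZI-maximum ℓ ls))

module _ {a b ℓ₁ ℓ₂ p} {B : Set b} {_≈_ : Rel B ℓ₁} {_≲_ : Rel B ℓ₂} (isPartialOrder : IsPartialOrder _≈_ _≲_)
         {A : Set a} {f : A → B} {m : B} {P : A → Set p}
         (bounded : ∀ x → f x ≲ m) (attained : ∀ x → f x ≈ m ⇔ P x) (witness : Σ A P) where

  open IsPartialOrder isPartialOrder using (antisym; reflexive; module Eq) renaming (trans to ≲-trans)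

  maximizer-value : ∀ x → (∀ y → f y ≲ f x) → f x ≈ m
  maximizer-value x maximal = antisym (bounded x) (≲-trans (reflexive (Eq.sym (Equivalence.from (attained x*) Px*))) (maximal x*))
    where
    x*  = proj₁ witness
    Px* = proj₂ witness

  maximizer⇔ : ∀ x → (∀ y → f y ≲ f x) ⇔ P x
  maximizer⇔ x = mk⇔ (Equivalence.to (attained x) ∘ maximizer-value x)
                     (λ Px y → ≲-trans (bounded y) (reflexive (Eq.sym (Equivalence.from (attained x) Px))))

toList-surjective : ∀ {A : Set} (xs : List A) {n} → length xs ≡ n → ∃[ v ] toList {n = n} v ≡ xs
toList-surjective xs refl = Vec.fromList xs , VecP.toList∘fromList xs

theorem3 : (n : ℕ) → 5 ≤ n →
    ((L : Vec Link (n ∸ 2)) → IsMaximizer n L ⇔ Extremal n (toList L))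
    × ((L : Vec Link (n ∸ 2)) → IsMaximizer n L → AZIchain n L ≡ M n)
theorem3 n 5≤n = maximizer⇔ ℚP.≤-isPartialOrder bounded attained witness ,
                 maximizer-value ℚP.≤-isPartialOrder bounded attained witness
  where
  length≡ : ∀ (ls : List Link) → length ls ≡ n ∸ 2 → length ls ℕ.+ 2 ≡ n
  length≡ _ eq = trans (cong (ℕ._+ 2) eq) (ℕP.m∸n+n≡m (ℕP.≤-trans (ℕP.m≤m+n 2 3) 5≤n))
  bounds : ∀ (L : Vec Link (n ∸ 2)) → AZIchain n L ℚ.≤ M n × (AZIchain n L ≡ M n ⇔ Extremal n (toList L))
  bounds L = AZI-bounds n (toList L) (ℕP.≤-trans (ℕP.m≤m+n 3 2) 5≤n) (length≡ (toList L) (VecP.length-toList L))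
  bounded : ∀ (L : Vec Link (n ∸ 2)) → AZIchain n L ℚ.≤ M n
  bounded = proj₁ ∘ bounds
  attained : ∀ (L : Vec Link (n ∸ 2)) → AZIchain n L ≡ M n ⇔ Extremal n (toList L)
  attained = proj₂ ∘ bounds
  witness : Σ (Vec Link (n ∸ 2)) (λ L → Extremal n (toList L))
  witness with ExtremalLinks-of-length (n ∸ 2) (ℕP.∸-monoˡ-≤ 2 5≤n)
  ... | ls , len , extremal with toList-surjective ls len
  ...   | L , refl = L , subst (λ k → Extremal k (toList L)) (length≡ ls len) (ExtremalLinks⇒Extremal extremal)
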